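{- $P_5\le C_4$.
   Context: All graphs are finite and simple, considered up to isomorphism. An edge-colored graph is a pair $(G,c)$ with $c\colon E(G)\to\mathbb{N}$ an arbitrary map (not necessarily proper); it is colored in $t$ or more colors if $|c(E(G))|\ge t$. A subgraph (not necessarily induced) is rainbow if its edges receive pairwise distinct colors. $(G,c)$ is rainbow $H$-free if $G$ contains no rainbow subgraph isomorphic to $H$. For graphs $H_1,H_2$, write $H_1\le H_2$ if there is a positive integer $t$ such that every rainbow $H_1$-free edge-colored complete graph colored in $t$ or more colors is rainbow $H_2$-free. $P_k$ and $C_k$ are the path and cycle on $k$ vertices. -}

module Defs where

open import Data.Nat using (ℕ; zero; suc; _<_; _+_)
open import Data.Fin using (Fin; toℕ)
open import Data.Product using (Σ; _×_; _,_; proj₁; proj₂)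
open import Data.Sum using (_⊎_)
open import Relation.Nullary using (¬_)
open import Relation.Binary.PropositionalEquality using (_≡_; _≢_)

-- A (simple) graph on the vertex set Fin k, given by its adjacency relation
-- (for the graphs used here it is symmetric and irreflexive).
Graph : ℕ → Set₁
Graph k = Fin k → Fin k → Set

Path : (k : ℕ) → Graph k
Path k i j = (toℕ j ≡ suc (toℕ i)) ⊎ (toℕ i ≡ suc (toℕ j))

Cycle : (k : ℕ) → Graph k
Cycle k i j = Path k i j ⊎ ((toℕ i ≡ 0 × suc (toℕ j) ≡ k) ⊎ (toℕ j ≡ 0 × suc (toℕ i) ≡ k))

-- An (arbitrary, not necessarily proper) edge-coloring of the complete graph K_n
-- on vertex set Fin n: the color of edge {i,j} (i ≠ j) is c i j = c j i.
-- Diagonal values c i i are meaningless and never used.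
Coloring : ℕ → Set
Coloring n = Fin n → Fin n → ℕ

SymmetricColoring : {n : ℕ} → Coloring n → Set
SymmetricColoring {n} c = (i j : Fin n) → c i j ≡ c j i

ColoredInAtLeast : {n : ℕ} → ℕ → Coloring n → Set
ColoredInAtLeast {n} t c =
  Σ (Fin t → Fin n × Fin n) λ e →
    ((s : Fin t) → proj₁ (e s) ≢ proj₂ (e s)) ×
    ((s s' : Fin t) → c (proj₁ (e s)) (proj₂ (e s)) ≡ c (proj₁ (e s')) (proj₂ (e s')) → s ≡ s')

RainbowCopy : {k n : ℕ} → Graph k → Coloring n → Set
RainbowCopy {k} {n} H c =
  Σ (Fin k → Fin n) λ φ →
    ((a b : Fin k) → φ a ≡ φ b → a ≡ b) ×
    ((a b a' b' : Fin k) → H a b → H a' b' →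
       c (φ a) (φ b) ≡ c (φ a') (φ b') →
       (a ≡ a' × b ≡ b') ⊎ (a ≡ b' × b ≡ a'))

RainbowFree : {k n : ℕ} → Graph k → Coloring n → Set
RainbowFree H c = ¬ RainbowCopy H c

_≼_ : {k l : ℕ} → Graph k → Graph l → Set
H₁ ≼ H₂ = Σ ℕ λ t → (0 < t) ×
  ((n : ℕ) (c : Coloring n) → SymmetricColoring c → ColoredInAtLeast t c →
     RainbowFree H₁ c → RainbowFree H₂ c)

{-# OPTIONS --safe #-}
-- Fix a rainbow 4-cycle A B C D in a rainbow-P₅-free colouring. For x outside the cycle, x followed
-- by the rainbow path of the cycle starting at a vertex v is a P₅, so the colour of xv repeats a
-- colour of that path and is therefore spanned by {A, B, C, D}. For x and w both outside, one of the
-- edge-disjoint arcs A B C and A D C avoids the colour of xA; x followed by that arc is a rainbow P₄,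
-- and prepending w shows that the colour of wx is the colour of xA or of an arc edge, again spanned.
-- So at most six colours occur, and t = 7 witnesses P₅ ≤ C₄.
module Submission where

open import Defs
open import Data.Nat as ℕ using (ℕ; zero; suc; z<s)
import Data.Nat.Properties as ℕ
open import Data.Nat.DivMod using (_mod_)
open import Data.Fin as Fin using (Fin; zero; suc; toℕ; inject₁; _≟_)
open import Data.Fin.Patterns
open import Data.Fin.Properties
  using (all?; any?; pigeonhole; <⇒≢; suc-injective; inject₁-injective; toℕ-inject₁)
open import Data.Vec.Functional using (_∷_; [])
open import Data.Product using (∃; ∃₂; _×_; _,_; proj₁; proj₂)
open import Data.Sum using (_⊎_; inj₁; inj₂)
open import Data.Empty using (⊥; ⊥-elim)
open import Function using (_∘_)
open import Function.Definitions using (Injective)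
open import Relation.Binary.Definitions using (Decidable)
open import Relation.Binary.PropositionalEquality
open import Relation.Nullary using (¬_; Dec; yes; no)
open import Relation.Nullary.Negation using (¬∃⟶∀¬)
open import Relation.Nullary.Decidable using (from-yes; ¬?; _×-dec_; _⊎-dec_; _→-dec_)

private
  variable
    k l m n : ℕ
    A : Set

SameEdge : A → A → A → A → Set
SameEdge a b a' b' = (a ≡ a' × b ≡ b') ⊎ (a ≡ b' × b ≡ a')

sameEdge? : (a b a' b' : Fin k) → Dec (SameEdge a b a' b')
sameEdge? a b a' b' = (a ≟ a' ×-dec b ≟ b') ⊎-dec (a ≟ b' ×-dec b ≟ a')

sameEdge-sym : {a b a' b' : A} → SameEdge a b a' b' → SameEdge a' b' a b
sameEdge-sym (inj₁ (refl , refl)) = inj₁ (refl , refl)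
sameEdge-sym (inj₂ (refl , refl)) = inj₂ (refl , refl)

sameEdge-trans : {a b a' b' a'' b'' : A} →
                 SameEdge a b a' b' → SameEdge a' b' a'' b'' → SameEdge a b a'' b''
sameEdge-trans (inj₁ (refl , refl)) e = e
sameEdge-trans (inj₂ (refl , refl)) (inj₁ (refl , refl)) = inj₂ (refl , refl)
sameEdge-trans (inj₂ (refl , refl)) (inj₂ (refl , refl)) = inj₁ (refl , refl)

-- RainbowCopy H c is definitionally Σ _ (IsRainbowCopy H c).
IsRainbowCopy : Graph k → Coloring n → (Fin k → Fin n) → Set
IsRainbowCopy H c φ =
  (∀ a b → φ a ≡ φ b → a ≡ b) ×
  (∀ a b a' b' → H a b → H a' b' → c (φ a) (φ b) ≡ c (φ a') (φ b') → SameEdge a b a' b')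

path? : ∀ k → Decidable (Path k)
path? k i j = (toℕ j ℕ.≟ suc (toℕ i)) ⊎-dec (toℕ i ℕ.≟ suc (toℕ j))

cycle? : ∀ k → Decidable (Cycle k)
cycle? k i j =
  path? k i j ⊎-dec ((toℕ i ℕ.≟ 0 ×-dec suc (toℕ j) ℕ.≟ k) ⊎-dec
                     (toℕ j ℕ.≟ 0 ×-dec suc (toℕ i) ℕ.≟ k))

IsEmbedding : Graph k → Graph l → (Fin k → Fin l) → Set
IsEmbedding H H' σ = (∀ a b → σ a ≡ σ b → a ≡ b) × (∀ a b → H a b → H' (σ a) (σ b))

isEmbedding? : {H : Graph k} {H' : Graph l} → Decidable H → Decidable H' →
               (σ : Fin k → Fin l) → Dec (IsEmbedding H H' σ)
isEmbedding? H? H'? σ =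
  all? (λ a → all? λ b → (σ a ≟ σ b) →-dec (a ≟ b)) ×-dec
  all? (λ a → all? λ b → H? a b →-dec H'? (σ a) (σ b))

fresh-head⇒injective : {g : Fin (suc n) → A} → Injective _≡_ _≡_ (g ∘ suc) →
                       (∀ i → g zero ≢ g (suc i)) → Injective _≡_ _≡_ g
fresh-head⇒injective tail-inj fresh {zero}  {zero}  _  = refl
fresh-head⇒injective tail-inj fresh {zero}  {suc j} eq = ⊥-elim (fresh j eq)
fresh-head⇒injective tail-inj fresh {suc i} {zero}  eq = ⊥-elim (fresh i (sym eq))
fresh-head⇒injective tail-inj fresh {suc i} {suc j} eq = cong suc (tail-inj eq)

∉-∷ : {y x : A} {v : Fin k → A} → y ≢ x → (∀ i → y ≢ v i) →
      ∀ i → y ≢ (x ∷ v) i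
∉-∷ y≢x y∉v zero    = y≢x
∉-∷ y≢x y∉v (suc i) = y∉v i

inject₁≢suc : (i : Fin k) → inject₁ i ≢ suc i
inject₁≢suc (suc i) eq = inject₁≢suc i (suc-injective eq)

successor⇒edge : (a b : Fin (suc k)) → toℕ b ≡ suc (toℕ a) →
                 ∃ λ i → a ≡ inject₁ i × b ≡ suc i
successor⇒edge {suc k} zero    (suc zero) refl = zero , refl , refl
successor⇒edge {suc k} (suc a) (suc b)    eq with successor⇒edge a b (ℕ.suc-injective eq)
... | i , refl , refl = suc i , refl , refl

Path⇒edge : {a b : Fin (suc k)} → Path (suc k) a b →
            ∃ λ i → SameEdge a b (inject₁ i) (suc i)
Path⇒edge (inj₁ b≡1+a) with successor⇒edge _ _ b≡1+a
... | i , refl , refl = i , inj₁ (refl , refl)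
Path⇒edge (inj₂ a≡1+b) with successor⇒edge _ _ a≡1+b
... | i , refl , refl = i , inj₂ (refl , refl)

path-edge : (i : Fin k) → Path (suc k) (inject₁ i) (suc i)
path-edge i = inj₁ (cong suc (sym (toℕ-inject₁ i)))

pathEdge-injective : {i j : Fin k} → SameEdge (inject₁ i) (suc i) (inject₁ j) (suc j) → i ≡ j
pathEdge-injective (inj₁ (p , _)) = inject₁-injective p
pathEdge-injective {i = i} {j} (inj₂ (p , q)) = ⊥-elim (ℕ.<-asym j<i i<j)
  where
  j<i : toℕ j ℕ.< toℕ i
  j<i = ℕ.≤-reflexive (trans (cong toℕ (sym p)) (toℕ-inject₁ i))
  i<j : toℕ i ℕ.< toℕ j
  i<j = ℕ.≤-reflexive (trans (cong toℕ q) (toℕ-inject₁ j))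

pathColors : Coloring n → (Fin (suc k) → Fin n) → Fin k → ℕ
pathColors c v i = c (v (inject₁ i)) (v (suc i))

PathEdgesDisjoint : (Fin (suc k) → Fin l) → (Fin (suc m) → Fin l) → Set
PathEdgesDisjoint σ τ = ∀ i j → ¬ SameEdge (σ (inject₁ i)) (σ (suc i)) (τ (inject₁ j)) (τ (suc j))

pathEdgesDisjoint? : (σ : Fin (suc k) → Fin l) (τ : Fin (suc m) → Fin l) → Dec (PathEdgesDisjoint σ τ)
pathEdgesDisjoint? σ τ =
  all? λ i → all? λ j → ¬? (sameEdge? (σ (inject₁ i)) (σ (suc i)) (τ (inject₁ j)) (τ (suc j)))

SpannedColor : Coloring n → (Fin m → Fin n) → ℕ → Set
SpannedColor c φ col = ∃₂ λ i j → i ≢ j × col ≡ c (φ i) (φ j)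

module Rainbow {n : ℕ} (c : Coloring n) (c-sym : SymmetricColoring c) where

  isRainbowCopy-∘ : {H : Graph k} {H' : Graph l} {φ : Fin l → Fin n} {σ : Fin k → Fin l} →
                    IsEmbedding H H' σ → IsRainbowCopy H' c φ → IsRainbowCopy H c (φ ∘ σ)
  isRainbowCopy-∘ {σ = σ} (σ-inj , σ-hom) (φ-inj , φ-rainbow) =
    (λ a b → σ-inj a b ∘ φ-inj (σ a) (σ b)) ,
    λ a b a' b' h h' eq → unembed (φ-rainbow _ _ _ _ (σ-hom a b h) (σ-hom a' b' h') eq)
    where
    unembed : ∀ {a b a' b'} → SameEdge (σ a) (σ b) (σ a') (σ b') → SameEdge a b a' b'
    unembed (inj₁ (p , q)) = inj₁ (σ-inj _ _ p , σ-inj _ _ q)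
    unembed (inj₂ (p , q)) = inj₂ (σ-inj _ _ p , σ-inj _ _ q)

  isRainbowCopy-Path : {v : Fin (suc k) → Fin n} → Injective _≡_ _≡_ v →
                       Injective _≡_ _≡_ (pathColors c v) → IsRainbowCopy (Path (suc k)) c v
  isRainbowCopy-Path {v = v} v-inj colors-inj = (λ _ _ → v-inj) , rainbow
    where
    color : ∀ {a b i} → SameEdge a b (inject₁ i) (suc i) → c (v a) (v b) ≡ pathColors c v i
    color (inj₁ (refl , refl)) = refl
    color (inj₂ (refl , refl)) = c-sym _ _
    rainbow : ∀ a b a' b' → Path _ a b → Path _ a' b' →
              c (v a) (v b) ≡ c (v a') (v b') → SameEdge a b a' b'
    rainbow _ _ _ _ p p' eq with Path⇒edge p | Path⇒edge p'
    ... | i , e | i' , e' with colors-inj (trans (sym (color e)) (trans eq (color e')))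
    ... | refl = sameEdge-trans e (sameEdge-sym e')

  pathColors-injective : {v : Fin (suc k) → Fin n} → IsRainbowCopy (Path (suc k)) c v →
                         Injective _≡_ _≡_ (pathColors c v)
  pathColors-injective (_ , rainbow) {i} {j} eq =
    pathEdge-injective (rainbow _ _ _ _ (path-edge i) (path-edge j) eq)

  isRainbowCopy-∷ : {v : Fin (suc k) → Fin n} {x : Fin n} → IsRainbowCopy (Path (suc k)) c v →
                    (∀ i → x ≢ v i) → (∀ i → c x (v zero) ≢ pathColors c v i) →
                    IsRainbowCopy (Path (suc (suc k))) c (x ∷ v)
  isRainbowCopy-∷ v-rainbow x∉v fresh-color =
    isRainbowCopy-Path (fresh-head⇒injective (proj₁ v-rainbow _ _) x∉v)
                       (fresh-head⇒injective (pathColors-injective v-rainbow) fresh-color)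

  extension-colorRepeats : RainbowFree (Path (suc (suc k))) c →
                           {v : Fin (suc k) → Fin n} {x : Fin n} →
                           IsRainbowCopy (Path (suc k)) c v → (∀ i → x ≢ v i) →
                           ∃ λ i → c x (v zero) ≡ pathColors c v i
  extension-colorRepeats free {v} {x} v-rainbow x∉v
    with any? (λ i → c x (v zero) ℕ.≟ pathColors c v i)
  ... | yes old = old
  ... | no  new = ⊥-elim (free (x ∷ v , isRainbowCopy-∷ v-rainbow x∉v (¬∃⟶∀¬ new)))

  pathColors-spanned : {φ : Fin l → Fin n} {σ : Fin (suc k) → Fin l} →
                       (∀ a b → σ a ≡ σ b → a ≡ b) →
                       ∀ i → SpannedColor c φ (pathColors c (φ ∘ σ) i)
  pathColors-spanned σ-inj i = _ , _ , inject₁≢suc i ∘ σ-inj _ _ , refl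

  pathColors-disjoint : {H : Graph l} {φ : Fin l → Fin n}
                        {σ : Fin (suc k) → Fin l} {τ : Fin (suc m) → Fin l} →
                        IsRainbowCopy H c φ →
                        IsEmbedding (Path (suc k)) H σ → IsEmbedding (Path (suc m)) H τ →
                        PathEdgesDisjoint σ τ →
                        ∀ i j → pathColors c (φ ∘ σ) i ≢ pathColors c (φ ∘ τ) j
  pathColors-disjoint (_ , φ-rainbow) (_ , σ-hom) (_ , τ-hom) edge-disjoint i j eq =
    edge-disjoint i j (φ-rainbow _ _ _ _ (σ-hom _ _ (path-edge i)) (τ-hom _ _ (path-edge j)) eq)

rotate : Fin 4 → Fin 4 → Fin 4
rotate j i = (toℕ j ℕ.+ toℕ i) mod 4

rotate-zero : ∀ j → rotate j zero ≡ j
rotate-zero 0F = refl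
rotate-zero 1F = refl
rotate-zero 2F = refl
rotate-zero 3F = refl

rotate-embedding : ∀ j → IsEmbedding (Path 4) (Cycle 4) (rotate j)
rotate-embedding = from-yes (all? λ j → isEmbedding? (path? 4) (cycle? 4) (rotate j))

arc₀₁₂ arc₀₃₂ : Fin 3 → Fin 4
arc₀₁₂ = 0F ∷ 1F ∷ 2F ∷ []
arc₀₃₂ = 0F ∷ 3F ∷ 2F ∷ []

arc₀₁₂-embedding : IsEmbedding (Path 3) (Cycle 4) arc₀₁₂
arc₀₁₂-embedding = from-yes (isEmbedding? (path? 3) (cycle? 4) arc₀₁₂)

arc₀₃₂-embedding : IsEmbedding (Path 3) (Cycle 4) arc₀₃₂
arc₀₃₂-embedding = from-yes (isEmbedding? (path? 3) (cycle? 4) arc₀₃₂)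

arcs-edgeDisjoint : PathEdgesDisjoint arc₀₁₂ arc₀₃₂
arcs-edgeDisjoint = from-yes (pathEdgesDisjoint? arc₀₁₂ arc₀₃₂)

module RainbowSquare {n : ℕ} (c : Coloring n) (c-sym : SymmetricColoring c)
                     (free : RainbowFree (Path 5) c)
                     {φ : Fin 4 → Fin n} (φ-rainbow : IsRainbowCopy (Cycle 4) c φ) where
  open Rainbow c c-sym

  spanned-oneOutside : ∀ {x} → (∀ i → x ≢ φ i) → ∀ j → SpannedColor c φ (c x (φ j))
  spanned-oneOutside {x} x∉φ j =
    subst (λ a → SpannedColor c φ (c x (φ a))) (rotate-zero j) spanned
    where
    extension : ∃ λ i → c x (φ (rotate j zero)) ≡ pathColors c (φ ∘ rotate j) i
    extension =
      extension-colorRepeats free (isRainbowCopy-∘ (rotate-embedding j) φ-rainbow)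
                             (x∉φ ∘ rotate j)
    spanned : SpannedColor c φ (c x (φ (rotate j zero)))
    spanned = subst (SpannedColor c φ) (sym (proj₂ extension))
                    (pathColors-spanned (proj₁ (rotate-embedding j)) (proj₁ extension))

  colorAvoidingArc : ∀ x → ∃ λ σ → IsEmbedding (Path 3) (Cycle 4) σ ×
                                   (∀ i → c x (φ (σ zero)) ≢ pathColors c (φ ∘ σ) i)
  colorAvoidingArc x with any? (λ i → c x (φ 0F) ℕ.≟ pathColors c (φ ∘ arc₀₁₂) i)
  ... | no  ∉arc₀₁₂       = arc₀₁₂ , arc₀₁₂-embedding , ¬∃⟶∀¬ ∉arc₀₁₂
  ... | yes (i , ∈arc₀₁₂) = arc₀₃₂ , arc₀₃₂-embedding , λ j eq →
    pathColors-disjoint φ-rainbow arc₀₁₂-embedding arc₀₃₂-embedding arcs-edgeDisjoint i j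
                        (trans (sym ∈arc₀₁₂) eq)

  spanned-bothOutside : ∀ {x w} → (∀ i → x ≢ φ i) → (∀ i → w ≢ φ i) → w ≢ x →
                        SpannedColor c φ (c w x)
  spanned-bothOutside {x} {w} x∉φ w∉φ w≢x with colorAvoidingArc x
  ... | σ , σ-embedding , fresh
    with extension-colorRepeats free
           (isRainbowCopy-∷ (isRainbowCopy-∘ σ-embedding φ-rainbow) (x∉φ ∘ σ) fresh)
           (∉-∷ w≢x (w∉φ ∘ σ))
  ... | zero  , eq = subst (SpannedColor c φ) (sym eq) (spanned-oneOutside x∉φ (σ zero))
  ... | suc i , eq =
    subst (SpannedColor c φ) (sym eq) (pathColors-spanned (proj₁ σ-embedding) i)

  allColors-spanned : ∀ u w → u ≢ w → SpannedColor c φ (c u w)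
  allColors-spanned u w u≢w with any? (λ i → u ≟ φ i) | any? (λ j → w ≟ φ j)
  ... | yes (i , refl) | yes (j , refl) = i , j , u≢w ∘ cong φ , refl
  ... | no  u∉φ        | yes (j , refl) = spanned-oneOutside (¬∃⟶∀¬ u∉φ) j
  ... | yes (i , refl) | no  w∉φ        =
    subst (SpannedColor c φ) (c-sym _ _) (spanned-oneOutside (¬∃⟶∀¬ w∉φ) i)
  ... | no  u∉φ        | no  w∉φ        =
    spanned-bothOutside (¬∃⟶∀¬ w∉φ) (¬∃⟶∀¬ u∉φ) u≢w

k4Edge : Fin 6 → Fin 4 × Fin 4
k4Edge = (0F , 1F) ∷ (0F , 2F) ∷ (0F , 3F) ∷ (1F , 2F) ∷ (1F , 3F) ∷ (2F , 3F) ∷ []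

k4Edge-complete : ∀ i j → i ≢ j →
                  ∃ λ p → SameEdge i j (proj₁ (k4Edge p)) (proj₂ (k4Edge p))
k4Edge-complete = from-yes (all? λ i → all? λ j →
  ¬? (i ≟ j) →-dec any? λ p → sameEdge? i j (proj₁ (k4Edge p)) (proj₂ (k4Edge p)))

k4Color : Coloring n → (Fin 4 → Fin n) → Fin 6 → ℕ
k4Color c φ p = c (φ (proj₁ (k4Edge p))) (φ (proj₂ (k4Edge p)))

spannedColor⇒k4Color : {c : Coloring n} {φ : Fin 4 → Fin n} {col : ℕ} → SymmetricColoring c →
                       SpannedColor c φ col → ∃ λ p → col ≡ k4Color c φ p
spannedColor⇒k4Color {c = c} {φ} c-sym (i , j , i≢j , refl) with k4Edge-complete i j i≢j
... | p , inj₁ (i≡ , j≡) = p , cong₂ (λ a b → c (φ a) (φ b)) i≡ j≡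
... | p , inj₂ (i≡ , j≡) = p , trans (c-sym _ _) (cong₂ (λ a b → c (φ a) (φ b)) j≡ i≡)

colorsAmong⇒¬coloredInAtLeast : {c : Coloring n} (g : Fin m → ℕ) →
                                (∀ u w → u ≢ w → ∃ λ p → c u w ≡ g p) →
                                ¬ ColoredInAtLeast (suc m) c
colorsAmong⇒¬coloredInAtLeast {m = m} {c = c} g covered (e , e-proper , e-rainbow) =
  collide (pigeonhole (ℕ.n<1+n m) (proj₁ ∘ cover))
  where
  cover : ∀ s → ∃ λ p → c (proj₁ (e s)) (proj₂ (e s)) ≡ g p
  cover s = covered _ _ (e-proper s)
  collide : (∃₂ λ s s' → s Fin.< s' × proj₁ (cover s) ≡ proj₁ (cover s')) → ⊥
  collide (s , s' , s<s' , same) =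
    <⇒≢ s<s' (e-rainbow s s'
      (trans (proj₂ (cover s)) (trans (cong g same) (sym (proj₂ (cover s'))))))

rainbowC4⇒¬coloredInAtLeast7 : {c : Coloring n} → SymmetricColoring c → RainbowFree (Path 5) c →
                               RainbowCopy (Cycle 4) c → ¬ ColoredInAtLeast 7 c
rainbowC4⇒¬coloredInAtLeast7 {c = c} c-sym free (φ , φ-rainbow) =
  colorsAmong⇒¬coloredInAtLeast (k4Color c φ) λ u w u≢w →
    spannedColor⇒k4Color c-sym (allColors-spanned u w u≢w)
  where open RainbowSquare c c-sym free φ-rainbow

corollary12 : Path 5 ≼ Cycle 4
corollary12 = 7 , z<s , λ n c c-sym many free c4 → rainbowC4⇒¬coloredInAtLeast7 c-sym free c4 many
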